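{- Let $k\ge r\ge3$, $p,t\ge0$, and let $\pi\in\mathbb{C}_{<}(k,r|p,t)$ satisfy $\pi^{(2)}_{p}\geq 2t+6$. Then $2t+2$ and $2t+4$ do not both occur as parts of $\pi$.
   Context: A partition is a finite non-increasing sequence of positive integers. $\mathbb{C}(k,r)$ is the set of partitions $\pi=(\pi_1,\dots,\pi_\ell)$ with no repeated odd part, $\pi_i\ge\pi_{i+k-1}+2$ for $1\le i\le\ell-k+1$ (strict if $\pi_i$ even), and at most $r-1$ parts $\le2$. Göllnitz–Gordon marking $GG(\pi)$: marks (positive integers) are assigned to the parts from smallest to largest, each as small as possible subject to: the mark of $\pi_i$ differs from the marks of all parts $\pi_g$, $g>i$, with $\pi_i-\pi_g\le2$ (strict if $\pi_i$ odd). A "$j$-marked $x$" is a part $x$ with mark $j$. $N_j$ is the number of $j$-marked parts and $\pi^{(j)}_1>\cdots>\pi^{(j)}_{N_j}$ are these parts; $\pi^{(j)}_0=+\infty$, $\pi^{(j)}_{N_j+1}=-\infty$. Starting types (for $N_2\ge1$): let $l$ be the largest integer $0\le l\le N_2$ such that no odd part of $\pi$ is $\ge\pi^{(2)}_l$; parts $\pi^{(2)}_i$, $i>l$, are of type $s_{ -1}$. For $b=1$: $\pi^{(2)}_1$ is of type $s_0$ [resp. $s_1$] with $s_1(\pi)=\pi^{(2)}_1-1$ [resp. $-2$] if there is a 1-marked $\pi^{(2)}_1-1$ [resp. $\pi^{(2)}_1-2$] and $\pi^{(2)}_1+2$ does not occur; of type $s_2$ ($s_1(\pi)=\pi^{(2)}_1+2$)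 if there is a 1-marked $\pi^{(2)}_1+2$; of type $s_3$ ($s_1(\pi)=\pi^{(2)}_1$) if there is a 1-marked $\pi^{(2)}_1$. For $b=2,\dots,l$: type $s_0$ [resp. $s_1$], $s_b(\pi)=\pi^{(2)}_b-1$ [resp. $-2$], if there is a 1-marked $\pi^{(2)}_b-1$ [resp. $-2$] and, whenever a 1-marked $\pi^{(2)}_b+2$ exists, $s_{b-1}(\pi)=\pi^{(2)}_b+2$; type $s_2$ ($s_b(\pi)=\pi^{(2)}_b+2$) if there is a 1-marked $\pi^{(2)}_b+2$ and $s_{b-1}(\pi)\neq\pi^{(2)}_b+2$; type $s_3$ ($s_b(\pi)=\pi^{(2)}_b$) if there is a 1-marked $\pi^{(2)}_b$. $\mathbb{C}_{<}(k,r|p,t)$ is the set of $\pi\in\mathbb{C}(k,r)$ such that: (1) no odd part is $\ge2t+1$; (2) $\pi^{(2)}_{p+1}<2t+1<\pi^{(2)}_p$; (3) if $\pi^{(2)}_p=2t+2$ it is of starting type $s_2$ or $s_3$; (4) if $\pi^{(2)}_{p+1}=2t$ it is of starting type $s_0$ or $s_1$. -}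

module Defs where

open import Data.Nat using (ℕ; zero; suc; _+_; _∸_; _≤_; _<_; _≟_; _≤?_; _*_)
open import Data.Nat.DivMod using (_%_)
open import Data.Bool using (Bool; true; false; if_then_else_; _∧_; not)
open import Data.List using (List; []; _∷_; length; reverse; filter; map)
open import Data.Bool.ListAction using (any)
open import Data.List.Membership.Propositional using (_∈_)
open import Data.List.Relation.Unary.All using (All)
open import Data.List.Relation.Unary.Linked using (Linked)
open import Data.Maybe using (Maybe; just; nothing; maybe)
open import Data.Product using (Σ; _×_; _,_; ∃)
open import Data.Empty using (⊥)
import Data.Sum
open import Relation.Nullary using (¬_; does)
open import Relation.Binary.PropositionalEquality using (_≡_; _≢_)

Even : ℕ → Set
Even n = n % 2 ≡ 0

Odd : ℕ → Set
Odd n = n % 2 ≡ 1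

isOdd : ℕ → Bool
isOdd n = does (n % 2 ≟ 1)

nth : List ℕ → ℕ → Maybe ℕ
nth []       _       = nothing
nth (x ∷ xs) zero    = just x
nth (x ∷ xs) (suc i) = nth xs i

_≥_ : ℕ → ℕ → Set
m ≥ n = n ≤ m

IsPartition : List ℕ → Set
IsPartition π = Linked _≥_ π × All (λ x → 0 < x) π

InC : ℕ → ℕ → List ℕ → Set
InC k r π =
  IsPartition π
  × (∀ i j x → i ≢ j → nth π i ≡ just x → nth π j ≡ just x → Even x)
  × (∀ i x y → nth π i ≡ just x → nth π (i + (k ∸ 1)) ≡ just y →
       (y + 2 ≤ x) × (Even x → y + 2 < x))
  × (length (filter (λ x → x ≤? 2) π) ≤ r ∸ 1)

-- Göllnitz–Gordon marking

elem : ℕ → List ℕ → Bool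
elem n xs = any (λ y → does (n ≟ y)) xs

search : ℕ → ℕ → List ℕ → ℕ
search zero    n xs = n
search (suc f) n xs = if elem n xs then search f (suc n) xs else n

mex : List ℕ → ℕ
mex xs = search (length xs) 1 xs

conflict : ℕ → ℕ → Bool
conflict x y = if isOdd x then does (x ∸ y ≤? 1) else does (x ∸ y ≤? 2)

forbidden : ℕ → List (ℕ × ℕ) → List ℕ
forbidden x []             = []
forbidden x ((y , m) ∷ acc) =
  if conflict x y then m ∷ forbidden x acc else forbidden x acc

markAsc : List (ℕ × ℕ) → List ℕ → List (ℕ × ℕ)
markAsc acc []       = acc
markAsc acc (x ∷ xs) = markAsc ((x , mex (forbidden x acc)) ∷ acc) xs

GG : List ℕ → List (ℕ × ℕ)
GG π = markAsc [] (reverse π)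

-- the j-marked parts, listed in decreasing order π^(j)_1 > π^(j)_2 > …
-- (markAsc returns the pairs with the largest part first)
markedParts : ℕ → List ℕ → List ℕ
markedParts j π = map (λ p → Data.Product.proj₁ p)
  (filter (λ p → Data.Product.proj₂ p ≟ j) (GG π))

N : ℕ → List ℕ → ℕ
N j π = length (markedParts j π)

Marked : ℕ → ℕ → List ℕ → Set
Marked j x π = (x , j) ∈ GG π

data ℕ± : Set where
  -∞  : ℕ±
  fin : ℕ → ℕ±
  +∞  : ℕ±

data _<ᵉ_ : ℕ± → ℕ± → Set where
  -∞<fin : ∀ {n} → -∞ <ᵉ fin n
  -∞<+∞  : -∞ <ᵉ +∞
  fin<fin : ∀ {m n} → m < n → fin m <ᵉ fin n
  fin<+∞ : ∀ {n} → fin n <ᵉ +∞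

data _≤ᵉ_ : ℕ± → ℕ± → Set where
  -∞≤ : ∀ {x} → -∞ ≤ᵉ x
  fin≤fin : ∀ {m n} → m ≤ n → fin m ≤ᵉ fin n
  ≤+∞ : ∀ {x} → x ≤ᵉ +∞

-- π^(j)_i with π^(j)_0 = +∞ and π^(j)_i = -∞ for i > N_j
partAt : ℕ → List ℕ → ℕ → ℕ±
partAt j π zero    = +∞
partAt j π (suc i) = maybe fin -∞ (nth (markedParts j π) i)

data SType : Set where
  s0 s1 s2 s3 : SType

baseCase : List ℕ → ℕ → SType → ℕ → Set
baseCase π x s0 v = Marked 1 (x ∸ 1) π × ¬ ((x + 2) ∈ π) × v ≡ x ∸ 1
baseCase π x s1 v = Marked 1 (x ∸ 2) π × ¬ ((x + 2) ∈ π) × v ≡ x ∸ 2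
baseCase π x s2 v = Marked 1 (x + 2) π × v ≡ x + 2
baseCase π x s3 v = Marked 1 x π × v ≡ x

-- b ≥ 2, where x = π^(2)_b and Prev w means s_{b-1}(π) = w
stepCase : List ℕ → ℕ → (ℕ → Set) → SType → ℕ → Set
stepCase π x Prev s0 v =
  Marked 1 (x ∸ 1) π × (Marked 1 (x + 2) π → Prev (x + 2)) × v ≡ x ∸ 1
stepCase π x Prev s1 v =
  Marked 1 (x ∸ 2) π × (Marked 1 (x + 2) π → Prev (x + 2)) × v ≡ x ∸ 2
stepCase π x Prev s2 v = Marked 1 (x + 2) π × ¬ Prev (x + 2) × v ≡ x + 2
stepCase π x Prev s3 v = Marked 1 x π × v ≡ x

-- STy π b ty v : π^(2)_b is of starting type ty with s_b(π) = v
-- (ignoring the constraint b ≤ l, which is added in StartType)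
STy : List ℕ → ℕ → SType → ℕ → Set
STy π zero          ty v = ⊥
STy π (suc zero)    ty v =
  Σ ℕ λ x → partAt 2 π 1 ≡ fin x × baseCase π x ty v
STy π (suc (suc b)) ty v =
  Σ ℕ λ x → partAt 2 π (suc (suc b)) ≡ fin x ×
    stepCase π x (λ w → Σ SType λ ty' → STy π (suc b) ty' w) ty v

NoOddAbove : List ℕ → ℕ → Set
NoOddAbove π l = ∀ y → y ∈ π → Odd y → fin y <ᵉ partAt 2 π l

IsL : List ℕ → ℕ → Set
IsL π l = l ≤ N 2 π × NoOddAbove π l
        × (∀ l' → l' ≤ N 2 π → NoOddAbove π l' → l' ≤ l)

StartType : List ℕ → ℕ → SType → ℕ → Set
StartType π b ty v = Σ ℕ λ l → IsL π l × 1 ≤ b × b ≤ l × STy π b ty v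

InC< : ℕ → ℕ → ℕ → ℕ → List ℕ → Set
InC< k r p t π =
  InC k r π
  × (∀ y → y ∈ π → Odd y → y < 2 * t + 1)
  × (partAt 2 π (suc p) <ᵉ fin (2 * t + 1))
  × (fin (2 * t + 1) <ᵉ partAt 2 π p)
  × (partAt 2 π p ≡ fin (2 * t + 2) →
       ∃ λ v → StartType π p s2 v Data.Sum.⊎ StartType π p s3 v)
  × (partAt 2 π (suc p) ≡ fin (2 * t) →
       ∃ λ v → StartType π (suc p) s0 v Data.Sum.⊎ StartType π (suc p) s1 v)

-- In the Göllnitz–Gordon marking, a part with mark m has, for each j = 1, …, m, a
-- j-marked part at most 2 below it, and two 1-marked parts never conflict.
-- Under the hypotheses no 2-marked part lies in [2t+1, 2t+5], so 2t+4 is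
-- 1-marked and hence 2t+2 is not.  So 2t+2 has a 2-marked part in [2t, 2t+2],
-- which forces π⁽²⁾_{p+1} = 2t, and a 1-marked part y in [2t, 2t+2].  But y is
-- not 2t+2 (it would conflict with 2t+4), not 2t+1 (odd parts are < 2t+1), and
-- not 2t (by (4), 2t is of starting type s₀ or s₁, so 2t−1 or 2t−2 is 1-marked).

module Submission where

open import Defs
open import Data.Nat using (ℕ; zero; suc; _+_; _*_; _∸_; _≤_; _<_; z≤n; s≤s)
open import Data.Nat.Properties
open import Data.Nat.DivMod using (_%_; [m+kn]%n≡m%n; m*n%n≡0)
open import Data.Bool using (true; false; T; _∨_)
open import Data.Unit using (tt)
open import Data.List using (List; []; _∷_; _∷ʳ_; reverse; length)
open import Data.List.Properties using (unfold-reverse)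
open import Data.List.Membership.Propositional using (_∈_; _∉_)
open import Data.List.Membership.Propositional.Properties using (∈-filter⁺; ∈-map⁺)
open import Data.List.Relation.Unary.Any using (here; there)
open import Data.List.Relation.Unary.All using (All; _∷_)
import Data.List.Relation.Unary.All as All
open import Data.List.Relation.Unary.AllPairs using (AllPairs; []; _∷_)
import Data.List.Relation.Unary.AllPairs.Properties as AllPairs
open import Data.List.Relation.Unary.Linked using (Linked)
open import Data.List.Relation.Unary.Linked.Properties using (Linked⇒AllPairs)
open import Data.Product using (_×_; _,_; proj₁; proj₂; map₁; map₂; ∃; ∃-syntax)
open import Data.Maybe using (maybe)
open import Data.Sum using (_⊎_; inj₁; inj₂; [_,_]′)
open import Data.Empty using (⊥; ⊥-elim)
open import Relation.Nullary using (¬_; Dec; does; yes; no; contradiction)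
open import Relation.Binary.PropositionalEquality
open import Function using (_on_; id)

Sorted : List ℕ → Set
Sorted = AllPairs _≥_

Linked⇒Sorted : ∀ {π} → Linked _≥_ π → Sorted π
Linked⇒Sorted = Linked⇒AllPairs (λ x≥y y≥z → ≤-trans y≥z x≥y)

elem⁺ : ∀ {n xs} → n ∈ xs → T (elem n xs)
elem⁺ {n} {x ∷ xs} = go (n ≟ x)
  where
  go : (n≟x : Dec (n ≡ x)) → n ∈ x ∷ xs → T (does n≟x ∨ elem n xs)
  go (yes _)   _            = tt
  go (no  n≢x) (here n≡x)   = contradiction n≡x n≢x
  go (no  _)   (there n∈xs) = elem⁺ n∈xs

elem⁻ : ∀ {n xs} → T (elem n xs) → n ∈ xs
elem⁻ {n} {x ∷ xs} = go (n ≟ x)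
  where
  go : (n≟x : Dec (n ≡ x)) → T (does n≟x ∨ elem n xs) → n ∈ x ∷ xs
  go (yes n≡x) _ = here n≡x
  go (no  _)   e = there (elem⁻ e)

n≤search : ∀ f n xs → n ≤ search f n xs
n≤search zero    n xs = ≤-refl
n≤search (suc f) n xs with elem n xs
... | true  = ≤-trans (n≤1+n n) (n≤search f (suc n) xs)
... | false = ≤-refl

search-minimal : ∀ f n xs {j} → n ≤ j → j < search f n xs → j ∈ xs
search-minimal zero    n xs n≤j j<n = contradiction n≤j (<⇒≱ j<n)
search-minimal (suc f) n xs {j} n≤j j<s with elem n xs in eq | n ≟ j
... | true  | yes refl = elem⁻ (subst T (sym eq) tt)
... | true  | no n≢j  = search-minimal f (suc n) xs (≤∧≢⇒< n≤j n≢j) j<s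
... | false | _       = contradiction n≤j (<⇒≱ j<s)

1≤mex : ∀ xs → 1 ≤ mex xs
1≤mex xs = n≤search (length xs) 1 xs

-- Enough for 1-marked parts; for larger marks, mex xs ∉ xs needs a pigeonhole argument.
mex≡1⇒1∉ : ∀ xs → mex xs ≡ 1 → 1 ∉ xs
mex≡1⇒1∉ (x ∷ xs) mex≡1 1∈ with elem 1 (x ∷ xs) in eq
... | true  = <-irrefl (sym mex≡1) (n≤search (length xs) 2 (x ∷ xs))
... | false = subst T eq (elem⁺ 1∈)

∈forbidden⁺ : ∀ x acc {y j} → (y , j) ∈ acc → T (conflict x y) → j ∈ forbidden x acc
∈forbidden⁺ x ((y , m) ∷ acc) y,j∈ c with conflict x y in eq | y,j∈
... | true  | here refl    = here refl
... | true  | there y,j∈′ = there (∈forbidden⁺ x acc y,j∈′ c)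
... | false | here refl    = ⊥-elim (subst T eq c)
... | false | there y,j∈′ = ∈forbidden⁺ x acc y,j∈′ c

∈forbidden⁻ : ∀ x acc {j} → j ∈ forbidden x acc → ∃[ y ] (y , j) ∈ acc × T (conflict x y)
∈forbidden⁻ x ((y , m) ∷ acc) j∈ with conflict x y in eq | j∈
... | true  | here refl = y , here refl , subst T (sym eq) tt
... | true  | there j∈′ = map₂ (map₁ there) (∈forbidden⁻ x acc j∈′)
... | false | j∈′       = map₂ (map₁ there) (∈forbidden⁻ x acc j∈′)

conflict⇒∸≤2 : ∀ x y → T (conflict x y) → x ∸ y ≤ 2
conflict⇒∸≤2 x y c with isOdd x
... | true  = ≤-trans (≤ᵇ⇒≤ (x ∸ y) 1 c) (n≤1+n 1)
... | false = ≤ᵇ⇒≤ (x ∸ y) 2 c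

conflict-even : ∀ {x y} → Even x → x ≤ y + 2 → T (conflict x y)
conflict-even {x} {y} ev x≤y+2 rewrite ev = ≤⇒≤ᵇ (m≤n+o⇒m∸n≤o x y x≤y+2)

markAsc-∷ʳ : ∀ acc ys x →
  markAsc acc (ys ∷ʳ x) ≡ (x , mex (forbidden x (markAsc acc ys))) ∷ markAsc acc ys
markAsc-∷ʳ acc []       x = refl
markAsc-∷ʳ acc (y ∷ ys) x = markAsc-∷ʳ _ ys x

GG-∷ : ∀ x π → GG (x ∷ π) ≡ (x , mex (forbidden x (GG π))) ∷ GG π
GG-∷ x π rewrite unfold-reverse x π = markAsc-∷ʳ [] (reverse π) x

Marked⇒∈ : ∀ {π m x} → Marked m x π → x ∈ π
Marked⇒∈ {x′ ∷ π} x∈ rewrite GG-∷ x′ π with x∈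
... | here refl = here refl
... | there x∈′ = there (Marked⇒∈ x∈′)

∈⇒Marked : ∀ {π x} → x ∈ π → ∃[ m ] Marked m x π
∈⇒Marked {x′ ∷ π} x∈ rewrite GG-∷ x′ π with x∈
... | here refl = _ , here refl
... | there x∈′ = map₂ there (∈⇒Marked x∈′)

Marked⇒1≤ : ∀ {π m x} → Marked m x π → 1 ≤ m
Marked⇒1≤ {x′ ∷ π} x∈ rewrite GG-∷ x′ π with x∈
... | here refl = 1≤mex (forbidden x′ (GG π))
... | there x∈′ = Marked⇒1≤ {π} x∈′

GG-sorted : ∀ {π} → Sorted π → AllPairs (_≥_ on proj₁) (GG π)
GG-sorted {[]}    []             = []
GG-sorted {x ∷ π} (x≥π ∷ sorted) rewrite GG-∷ x π =
  All.tabulate (λ x∈ → All.lookup x≥π (Marked⇒∈ x∈)) ∷ GG-sorted sorted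

lower-mark-conflicts : ∀ {π m z j} → Sorted π → Marked m z π → 1 ≤ j → j < m →
  ∃[ y ] Marked j y π × y ≤ z × T (conflict z y)
lower-mark-conflicts {x ∷ π} (x≥π ∷ sorted) z∈ 1≤j j<m rewrite GG-∷ x π with z∈
... | here refl =
  let forbidden = forbidden x (GG π)
      y , y∈ , c = ∈forbidden⁻ x (GG π) (search-minimal (length forbidden) 1 forbidden 1≤j j<m)
  in y , there y∈ , All.lookup x≥π (Marked⇒∈ y∈) , c
... | there z∈′ =
  let y , y∈ , y≤z , c = lower-mark-conflicts sorted z∈′ 1≤j j<m in y , there y∈ , y≤z , c

1-marked-conflict-free : ∀ {π x y} → Sorted π → Marked 1 x π → Marked 1 y π → y < x →
  ¬ T (conflict x y)
1-marked-conflict-free {z ∷ π} {y = y} (z≥π ∷ sorted) x∈ y∈ y<x c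
  rewrite GG-∷ z π with x∈ | y∈
... | here x≡z  | here y≡z  = <-irrefl (trans (cong proj₁ y≡z) (sym (cong proj₁ x≡z))) y<x
... | here x≡z  | there y∈′ =
  mex≡1⇒1∉ _ (sym (cong proj₂ x≡z))
    (∈forbidden⁺ z (GG π) y∈′ (subst (λ x → T (conflict x y)) (cong proj₁ x≡z) c))
... | there x∈′ | here y≡z  =
  <⇒≱ y<x (subst (_ ≤_) (sym (cong proj₁ y≡z)) (All.lookup z≥π (Marked⇒∈ x∈′)))
... | there x∈′ | there y∈′ = 1-marked-conflict-free sorted x∈′ y∈′ y<x c

MarkedBelow : ℕ → ℕ → List ℕ → Set
MarkedBelow j z π = ∃[ y ] Marked j y π × y ≤ z × z ≤ y + 2

marked-below : ∀ {π m z j} → Sorted π → Marked m z π → 1 ≤ j → j ≤ m → MarkedBelow j z π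
marked-below {z = z} sorted z∈ 1≤j j≤m with m≤n⇒m<n∨m≡n j≤m
... | inj₁ j<m  = let y , y∈ , y≤z , c = lower-mark-conflicts sorted z∈ 1≤j j<m
                  in y , y∈ , y≤z , ≤-trans (m≤n+m∸n z y) (+-monoʳ-≤ y (conflict⇒∸≤2 z y c))
... | inj₂ refl = z , z∈ , ≤-refl , m≤m+n z 2

1-marked⊎marked-below : ∀ {π z} → Sorted π → z ∈ π →
  Marked 1 z π ⊎ (MarkedBelow 1 z π × MarkedBelow 2 z π)
1-marked⊎marked-below {π} sorted z∈ with ∈⇒Marked z∈
... | 0           , z∈GG = contradiction (Marked⇒1≤ {π} z∈GG) λ ()
... | 1           , z∈GG = inj₁ z∈GG
... | suc (suc _) , z∈GG = inj₂ ( marked-below sorted z∈GG (s≤s z≤n) (s≤s z≤n)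
                                , marked-below sorted z∈GG (s≤s z≤n) (s≤s (s≤s z≤n)))

-- partAt j π i is lookup± (markedParts j π) i, definitionally once i is a
-- constructor; stating it for arbitrary lists makes induction possible.
lookup± : List ℕ → ℕ → ℕ±
lookup± xs zero    = +∞
lookup± xs (suc i) = maybe fin -∞ (nth xs i)

lookup±-bounded : ∀ {x} xs → All (_≤ x) xs → ∀ i → lookup± xs (suc i) ≤ᵉ fin x
lookup±-bounded []       _            i       = -∞≤
lookup±-bounded (y ∷ ys) (y≤x ∷ _)    zero    = fin≤fin y≤x
lookup±-bounded (y ∷ ys) (_ ∷ ys≤x) (suc i) = lookup±-bounded ys ys≤x i

lookup±-split : ∀ {xs y} → Sorted xs → y ∈ xs → ∀ p →
  fin y ≤ᵉ lookup± xs (suc p) ⊎ lookup± xs p ≤ᵉ fin y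
lookup±-split {x ∷ xs} _ (here refl) zero = inj₁ (fin≤fin ≤-refl)
lookup±-split {x ∷ xs} (x≥xs ∷ _) (here refl) (suc p) =
  inj₂ (lookup±-bounded (x ∷ xs) (≤-refl ∷ x≥xs) p)
lookup±-split (x≥xs ∷ _) (there y∈) zero = inj₁ (fin≤fin (All.lookup x≥xs y∈))
lookup±-split (_ ∷ sorted) (there y∈) (suc p) with lookup±-split sorted y∈ p
... | inj₁ y≤next = inj₁ y≤next
lookup±-split (_ ∷ sorted) (there y∈) (suc (suc p)) | inj₂ prev≤y = inj₂ prev≤y

markedParts-sorted : ∀ {π} j → Sorted π → Sorted (markedParts j π)
markedParts-sorted j sorted =
  AllPairs.map⁺ (AllPairs.filter⁺ (λ q → proj₂ q ≟ j) (GG-sorted sorted))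

Marked⇒∈markedParts : ∀ {π j y} → Marked j y π → y ∈ markedParts j π
Marked⇒∈markedParts {j = j} y∈ = ∈-map⁺ proj₁ (∈-filter⁺ (λ q → proj₂ q ≟ j) y∈ refl)

marked-split : ∀ {π j y} → Sorted π → Marked j y π → ∀ p →
  fin y ≤ᵉ partAt j π (suc p) ⊎ partAt j π p ≤ᵉ fin y
marked-split {π} {j} sorted y∈ zero =
  lookup±-split (markedParts-sorted j sorted) (Marked⇒∈markedParts {π} y∈) zero
marked-split {π} {j} sorted y∈ (suc p) =
  lookup±-split (markedParts-sorted j sorted) (Marked⇒∈markedParts {π} y∈) (suc p)

marked-squeezed : ∀ {π j p n v y} → Sorted π →
  partAt j π (suc p) <ᵉ fin (n + 1) → fin v ≤ᵉ partAt j π p →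
  Marked j y π → n ≤ y → y < v → y ≡ n × partAt j π (suc p) ≡ fin n
marked-squeezed {π} {p = p} {n} {v} {y} sorted next<n+1 v≤prev y∈ n≤y y<v
  with marked-split {π} sorted y∈ p
... | inj₁ y≤next = squeeze y≤next next<n+1
  where
  squeeze : ∀ {e} → fin y ≤ᵉ e → e <ᵉ fin (n + 1) → y ≡ n × e ≡ fin n
  squeeze {fin x} (fin≤fin y≤x) (fin<fin x<n+1) =
    ≤-antisym (≤-trans y≤x x≤n) n≤y , cong fin (≤-antisym x≤n (≤-trans n≤y y≤x))
    where
    x≤n : x ≤ n
    x≤n = m<1+n⇒m≤n (subst (x <_) (+-comm n 1) x<n+1)
... | inj₂ prev≤y = contradiction (v≤y v≤prev prev≤y) (<⇒≱ y<v)
  where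
  v≤y : ∀ {e} → fin v ≤ᵉ e → e ≤ᵉ fin y → v ≤ y
  v≤y (fin≤fin v≤x) (fin≤fin x≤y) = ≤-trans v≤x x≤y

s0⊎s1⇒1-marked-below : ∀ {π b x} →
  ∃ (λ v → StartType π b s0 v ⊎ StartType π b s1 v) → partAt 2 π b ≡ fin x →
  Marked 1 (x ∸ 1) π ⊎ Marked 1 (x ∸ 2) π
s0⊎s1⇒1-marked-below (_ , inj₁ (_ , _ , _ , _ , sty)) b≡x = inj₁ (from-s0 _ sty b≡x)
  where
  from-s0 : ∀ {π x v} b → STy π b s0 v → partAt 2 π b ≡ fin x → Marked 1 (x ∸ 1) π
  from-s0 1               (_ , b≡x′ , x′-1∈ , _) b≡x with trans (sym b≡x′) b≡x
  ... | refl = x′-1∈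
  from-s0 (suc (suc _)) (_ , b≡x′ , x′-1∈ , _) b≡x with trans (sym b≡x′) b≡x
  ... | refl = x′-1∈
s0⊎s1⇒1-marked-below (_ , inj₂ (_ , _ , _ , _ , sty)) b≡x = inj₂ (from-s1 _ sty b≡x)
  where
  from-s1 : ∀ {π x v} b → STy π b s1 v → partAt 2 π b ≡ fin x → Marked 1 (x ∸ 2) π
  from-s1 1               (_ , b≡x′ , x′-2∈ , _) b≡x with trans (sym b≡x′) b≡x
  ... | refl = x′-2∈
  from-s1 (suc (suc _)) (_ , b≡x′ , x′-2∈ , _) b≡x with trans (sym b≡x′) b≡x
  ... | refl = x′-2∈

even-1-marked-gap : ∀ {π x y} → Sorted π → Even x → Marked 1 x π → Marked 1 y π →
  y < x → x ≤ y + 2 → ⊥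
even-1-marked-gap sorted even x∈ y∈ y<x x≤y+2 =
  1-marked-conflict-free sorted x∈ y∈ y<x (conflict-even even x≤y+2)

[2*t+c]%2≡c%2 : ∀ t c → (2 * t + c) % 2 ≡ c % 2
[2*t+c]%2≡c%2 t c = trans (cong (_% 2) (trans (+-comm (2 * t) c) (cong (c +_) (*-comm 2 t))))
                          ([m+kn]%n≡m%n c t 2)

even-2*t : ∀ t → Even (2 * t)
even-2*t t = trans (cong (_% 2) (*-comm 2 t)) (m*n%n≡0 t 2)

m∸n<m : ∀ {n c} → 0 < n → 0 < c → n ∸ c < n
m∸n<m {suc n} {suc c} _ _ = s≤s (m∸n≤m n c)

m≤m∸n+2 : ∀ n {c} → c ≤ 2 → n ≤ n ∸ c + 2
m≤m∸n+2 n {c} c≤2 = begin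
  n           ≤⟨ m≤n+m∸n n c ⟩
  c + (n ∸ c) ≤⟨ +-monoˡ-≤ (n ∸ c) c≤2 ⟩
  2 + (n ∸ c) ≡⟨ +-comm 2 (n ∸ c) ⟩
  n ∸ c + 2   ∎
  where open ≤-Reasoning

between-n-n+2 : ∀ {n y} → n ≤ y → y ≤ n + 2 → y ≡ n ⊎ y ≡ n + 1 ⊎ y ≡ n + 2
between-n-n+2 {n} {y} n≤y y≤n+2 = go (y ∸ n) (m+[n∸m]≡n n≤y) (m≤n+o⇒m∸n≤o y n y≤n+2)
  where
  go : ∀ d → n + d ≡ y → d ≤ 2 → y ≡ n ⊎ y ≡ n + 1 ⊎ y ≡ n + 2
  go 0 n+0≡y _ = inj₁ (trans (sym n+0≡y) (+-identityʳ n))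
  go 1 refl  _ = inj₂ (inj₁ refl)
  go 2 refl  _ = inj₂ (inj₂ refl)
  go (suc (suc (suc _))) _ (s≤s (s≤s ()))

module TwoMarkedGap {π p t} (sorted : Sorted π)
  (next<2t+1 : partAt 2 π (suc p) <ᵉ fin (2 * t + 1))
  (2t+6≤prev : fin (2 * t + 6) ≤ᵉ partAt 2 π p) where

  2-marked-near-2t : ∀ {y} → Marked 2 y π → 2 * t ≤ y → y ≤ 2 * t + 4 →
    y ≡ 2 * t × partAt 2 π (suc p) ≡ fin (2 * t)
  2-marked-near-2t {y} y∈ 2t≤y y≤2t+4 =
    marked-squeezed sorted next<2t+1 2t+6≤prev y∈ 2t≤y y<2t+6
    where
    y<2t+6 : y < 2 * t + 6
    y<2t+6 = ≤-<-trans y≤2t+4 (+-monoʳ-< (2 * t) (s≤s (s≤s (s≤s (s≤s (s≤s z≤n))))))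

  2t+4-1-marked : 2 * t + 4 ∈ π → Marked 1 (2 * t + 4) π
  2t+4-1-marked 2t+4∈ = [ id , (λ (_ , below) → contradiction below no-2-marked-below) ]′
                           (1-marked⊎marked-below sorted 2t+4∈)
    where
    no-2-marked-below : ¬ MarkedBelow 2 (2 * t + 4) π
    no-2-marked-below (y , y∈ , y≤2t+4 , 2t+4≤y+2) =
      <⇒≱ (m<m+n (2 * t) (s≤s z≤n)) (subst (2 * t + 2 ≤_) y≡2t 2t+2≤y)
      where
      2t+2≤y : 2 * t + 2 ≤ y
      2t+2≤y = +-cancelʳ-≤ 2 (2 * t + 2) y (subst (_≤ y + 2) (sym (+-assoc (2 * t) 2 2)) 2t+4≤y+2)
      y≡2t : y ≡ 2 * t
      y≡2t = proj₁ (2-marked-near-2t y∈ (m+n≤o⇒m≤o (2 * t) 2t+2≤y) y≤2t+4)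

  2t+2-not-1-marked : 2 * t + 4 ∈ π → ¬ Marked 1 (2 * t + 2) π
  2t+2-not-1-marked 2t+4∈ 2t+2∈ =
    even-1-marked-gap sorted ([2*t+c]%2≡c%2 t 4) (2t+4-1-marked 2t+4∈) 2t+2∈
      (+-monoʳ-< (2 * t) (s≤s (s≤s (s≤s z≤n)))) (≤-reflexive (sym (+-assoc (2 * t) 2 2)))

  2-marked-below-2t+2 : MarkedBelow 2 (2 * t + 2) π → partAt 2 π (suc p) ≡ fin (2 * t)
  2-marked-below-2t+2 (y , y∈ , y≤2t+2 , 2t+2≤y+2) =
    proj₂ (2-marked-near-2t y∈ (+-cancelʳ-≤ 2 (2 * t) y 2t+2≤y+2)
                               (≤-trans y≤2t+2 (+-monoʳ-≤ (2 * t) (s≤s (s≤s z≤n)))))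

  no-1-marked-below-2t+2 : All (0 <_) π → (∀ y → y ∈ π → Odd y → y < 2 * t + 1) →
    2 * t + 4 ∈ π → Marked 1 (2 * t ∸ 1) π ⊎ Marked 1 (2 * t ∸ 2) π →
    ¬ MarkedBelow 1 (2 * t + 2) π
  no-1-marked-below-2t+2 positive odd<2t+1 2t+4∈ 1-marked-below-2t (y , y∈ , y≤2t+2 , 2t+2≤y+2)
    with between-n-n+2 (+-cancelʳ-≤ 2 (2 * t) y 2t+2≤y+2) y≤2t+2
  ... | inj₂ (inj₂ refl) = 2t+2-not-1-marked 2t+4∈ y∈
  ... | inj₂ (inj₁ refl) =
    <-irrefl refl (odd<2t+1 (2 * t + 1) (Marked⇒∈ {π} y∈) ([2*t+c]%2≡c%2 t 1))
  ... | inj₁ refl        = [ 2t∸c-not-1-marked (s≤s z≤n) (s≤s z≤n)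
                             , 2t∸c-not-1-marked (s≤s z≤n) ≤-refl ]′ 1-marked-below-2t
    where
    2t∸c-not-1-marked : ∀ {c} → 1 ≤ c → c ≤ 2 → ¬ Marked 1 (2 * t ∸ c) π
    2t∸c-not-1-marked 1≤c c≤2 w∈ = even-1-marked-gap sorted (even-2*t t) y∈ w∈
      (m∸n<m (All.lookup positive (Marked⇒∈ {π} y∈)) 1≤c) (m≤m∸n+2 (2 * t) c≤2)

corollary2p5 : ∀ (k r p t : ℕ) (π : List ℕ) → 3 ≤ r → r ≤ k →
    InC< k r p t π → fin (2 * t + 6) ≤ᵉ partAt 2 π p →
    ¬ (((2 * t + 2) ∈ π) × ((2 * t + 4) ∈ π))
corollary2p5 _ _ p t π _ _
  (((chain , positive) , _) , odd<2t+1 , next<2t+1 , _ , _ , next≡2t⇒s0⊎s1)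
  2t+6≤prev (2t+2∈ , 2t+4∈) =
  [ 2t+2-not-1-marked 2t+4∈
  , (λ (below₁ , below₂) →
       let next≡2t = 2-marked-below-2t+2 below₂
       in no-1-marked-below-2t+2 positive odd<2t+1 2t+4∈
            (s0⊎s1⇒1-marked-below (next≡2t⇒s0⊎s1 next≡2t) next≡2t) below₁)
  ]′ (1-marked⊎marked-below sorted 2t+2∈)
  where
  sorted : Sorted π
  sorted = Linked⇒Sorted chain
  open TwoMarkedGap {π} {p} {t} sorted next<2t+1 2t+6≤prev
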